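{- For any two partitions $\mathcal{P}_1,\mathcal{P}_2$ of the set $[n]$, there exists a partition of $[n]$ into $m<2\sqrt{n}$ base sets $B_1,\dots,B_m$ such that for every $i\in[m]$, either $d_{B_i}(\mathcal{P}_1,\mathcal{P}_2)=1$ or $d_{B_i}(\mathcal{P}_2,\mathcal{P}_1)=1$.
   Context: Parts of a partition are called colors. For a partition $\mathcal{P}$ of $[n]$ and $B\subseteq[n]$, $\mathcal{P}|_B$ is the partition of $B$ whose colors are the nonempty sets $Y\cap B$, $Y\in\mathcal{P}$. The distance $d(\mathcal{P}_1,\dots,\mathcal{P}_c)$ of a sequence of partitions of a set is the least $\Delta$ such that for every $i\in\{2,\dots,c\}$ and every color $Y_1\in\mathcal{P}_i$ there exist colors $Y_2,\dots,Y_{\Delta'}\in\mathcal{P}_i$, $\Delta'\le\Delta$, with $Y_1\cup\dots\cup Y_{\Delta'}$ equal to a union of some colors of $\mathcal{P}_j$ for every $j\in[i-1]$. For $B\subseteq[n]$, $d_B(\mathcal{P}_1,\dots,\mathcal{P}_c):=d(\mathcal{P}_1|_B,\dots,\mathcal{P}_c|_B)$. -}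

module Defs where

open import Data.Nat using (ℕ; suc; _≤_; _<_; _*_)
open import Data.Fin using (Fin; toℕ)
open import Data.List using (List; _∷_; length)
open import Data.List.Relation.Unary.Any using (Any)
open import Data.List.Relation.Unary.All using (All)
open import Data.Product using (Σ; ∃; _×_)
open import Relation.Binary.PropositionalEquality using (_≡_)
open import Relation.Nullary using (¬_)
open import Function.Bundles using (_⇔_)

-- A partition of [n] = Fin n is represented by a colouring f : Fin n → ℕ;
-- its colours are the nonempty fibres of f.
Partition : ℕ → Set
Partition n = Fin n → ℕ

SubsetP : ℕ → Set₁
SubsetP n = Fin n → Set

-- The union of the colours of P|_B containing the elements of xs
-- (each colour of P|_B is {y ∈ B | f y = f x} for some x ∈ B).
UnionOfColoursOf : ∀ {n} → SubsetP n → Partition n → List (Fin n) → SubsetP n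
UnionOfColoursOf B f xs y = B y × Any (λ z → f y ≡ f z) xs

-- S ⊆ B is a union of some colours of P|_B: there is a set K of colour
-- labels with S = ⋃_{k ∈ K} {y ∈ B | f y = k}.
IsUnionOfColours : ∀ {n} → SubsetP n → Partition n → SubsetP n → Set₁
IsUnionOfColours B f S = ∃ λ (K : ℕ → Set) → ∀ y → B y → (S y ⇔ K (f y))

-- d_B(P_1,…,P_c) ≤ Δ (the defining condition for Δ), sequence indexed by Fin c.
DistCond : ∀ {n c} → SubsetP n → (Fin c → Partition n) → ℕ → Set₁
DistCond {n} {c} B Ps Δ =
  ∀ (i : Fin c) → 1 ≤ toℕ i →
  ∀ (x : Fin n) → B x →
  Σ (List (Fin n)) λ ys →
    All B ys × suc (length ys) ≤ Δ ×
    (∀ (j : Fin c) → toℕ j < toℕ i →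
       IsUnionOfColours B (Ps j) (UnionOfColoursOf B (Ps i) (x ∷ ys)))

DistB≡ : ∀ {n c} → SubsetP n → (Fin c → Partition n) → ℕ → Set₁
DistB≡ B Ps Δ = DistCond B Ps Δ × (∀ Δ' → Δ' < Δ → ¬ DistCond B Ps Δ')

-- Choose b with b² < n ≤ (b+1)². Let r x count the elements of the P₁-colour of x
-- whose P₂-colour is smaller than that of x. If r x < b, label x by r x: within a
-- P₁-colour r separates the P₂-colours, so on such blocks P₁ refines P₂. Otherwise
-- the P₁-colour of x has more than b elements; label x by b + ⌊u x/(b+1)⌋, where
-- u x counts the elements of large P₁-colours smaller than that of x. Distinct
-- large colours get distinct labels, so each such block lies in one P₁-colour.
-- At most b + ⌊n/(b+1)⌋ labels occur, and (b + ⌊n/(b+1)⌋)² < 4n.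
module Submission where

open import Defs
open import Data.Nat using (ℕ; _≤_; _<_; _*_)
open import Data.Fin using (Fin)
open import Data.Vec using (lookup; _∷_; [])
open import Data.Product using (∃; _×_)
open import Data.Sum using (_⊎_)
open import Relation.Binary.PropositionalEquality using (_≡_)

open import Level using (0ℓ)
open import Data.Bool using (if_then_else_)
open import Data.Empty using (⊥-elim)
open import Data.Nat using (zero; suc; _+_; _/_; NonZero; z≤n; s≤s; _≟_; _<?_; _≤?_)
open import Data.Nat.Properties
open import Data.Nat.DivMod using (/-monoˡ-≤; m/n*n≤m; n/n≡1; +-distrib-/-∣ʳ)
open import Data.Nat.Divisibility using (∣-refl)
open import Data.Nat.Solver using (module +-*-Solver)
open import Data.Fin using (zero; suc; toℕ; fromℕ<) renaming (_≟_ to _≟ᶠ_)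
open import Data.Fin.Properties using (any?; injective⇒≤; toℕ-fromℕ<)
open import Data.List using (_∷_; [])
open import Data.List.Relation.Unary.Any using (here)
open import Data.List.Relation.Unary.All using ([])
open import Data.Product using (_,_; proj₁; proj₂)
open import Data.Sum using (inj₁; inj₂)
open import Function.Base using (_∘_)
open import Function.Bundles using (mk⇔)
open import Function.Definitions using (Injective)
open import Relation.Nullary using (¬_; Dec; yes; no; does; contradiction)
open import Relation.Unary using (Pred; Decidable; _⊆_; _⊥_)
open import Relation.Unary.Properties using (_∩?_)
open import Relation.Binary using (tri<; tri≈; tri>)
open import Relation.Binary.PropositionalEquality
  using (refl; sym; trans; cong; subst; module ≡-Reasoning)

count : ∀ {n} {P : Pred (Fin n) 0ℓ} → Decidable P → ℕ
count {zero}  P? = 0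
count {suc n} P? = (if does (P? zero) then 1 else 0) + count (P? ∘ suc)

count≤n : ∀ {n} {P : Pred (Fin n) 0ℓ} (P? : Decidable P) → count P? ≤ n
count≤n {zero}  P? = z≤n
count≤n {suc n} P? with P? zero
... | yes _ = s≤s (count≤n (P? ∘ suc))
... | no  _ = m≤n⇒m≤1+n (count≤n (P? ∘ suc))

count-pos : ∀ {n} {P : Pred (Fin n) 0ℓ} (P? : Decidable P) {x} → P x → 0 < count P?
count-pos {suc n} P? {zero} p with P? zero
... | yes _ = s≤s z≤n
... | no ¬p = contradiction p ¬p
count-pos {suc n} P? {suc x} p = ≤-trans (count-pos (P? ∘ suc) p) (m≤n+m _ _)

count-mono : ∀ {n} {P Q : Pred (Fin n) 0ℓ} (P? : Decidable P) (Q? : Decidable Q) →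
  P ⊆ Q → count P? ≤ count Q?
count-mono {zero}  P? Q? P⊆Q = z≤n
count-mono {suc n} P? Q? P⊆Q
  with P? zero | Q? zero | count-mono (P? ∘ suc) (Q? ∘ suc) P⊆Q
... | yes _ | yes _ | rest = s≤s rest
... | yes p | no ¬q | _    = contradiction (P⊆Q p) ¬q
... | no _  | yes _ | rest = m≤n⇒m≤1+n rest
... | no _  | no _  | rest = rest

count-disjoint-≤ : ∀ {n} {P Q R : Pred (Fin n) 0ℓ}
  (P? : Decidable P) (Q? : Decidable Q) (R? : Decidable R) →
  P ⊥ Q → P ⊆ R → Q ⊆ R → count P? + count Q? ≤ count R?
count-disjoint-≤ {zero} P? Q? R? P⊥Q P⊆R Q⊆R = z≤n
count-disjoint-≤ {suc n} P? Q? R? P⊥Q P⊆R Q⊆R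
  with P? zero | Q? zero | R? zero
     | count-disjoint-≤ (P? ∘ suc) (Q? ∘ suc) (R? ∘ suc) P⊥Q P⊆R Q⊆R
... | yes p | yes q | _     | _    = ⊥-elim (P⊥Q (p , q))
... | yes p | no _  | no ¬r | _    = contradiction (P⊆R p) ¬r
... | no _  | yes q | no ¬r | _    = contradiction (Q⊆R q) ¬r
... | yes _ | no _  | yes _ | rest = s≤s rest
... | no _  | yes _ | yes _ | rest = ≤-trans (≤-reflexive (+-suc _ _)) (s≤s rest)
... | no _  | no _  | yes _ | rest = m≤n⇒m≤1+n rest
... | no _  | no _  | no _  | rest = rest

m+n≤o⇒m/n<o/n : ∀ {m o} n .{{_ : NonZero n}} → m + n ≤ o → m / n < o / n
m+n≤o⇒m/n<o/n {m} {o} n m+n≤o = begin-strict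
  m / n          <⟨ m<m+n (m / n) (≤-reflexive (sym (n/n≡1 n))) ⟩
  m / n + n / n  ≡⟨ +-distrib-/-∣ʳ m ∣-refl ⟨
  (m + n) / n    ≤⟨ /-monoˡ-≤ n m+n≤o ⟩
  o / n          ∎
  where open ≤-Reasoning

module Rank {n} {S : Pred (Fin n) 0ℓ} (S? : Decidable S) (κ : Fin n → ℕ) where

  below? : ∀ x → Decidable (λ z → S z × κ z < κ x)
  below? x = S? ∩? λ z → κ z <? κ x

  level? : ∀ x → Decidable (λ z → S z × κ z ≡ κ x)
  level? x = S? ∩? λ z → κ z ≟ κ x

  rank multiplicity : Fin n → ℕ
  rank x         = count (below? x)
  multiplicity x = count (level? x)

  multiplicity-pos : ∀ {x} → S x → 0 < multiplicity x
  multiplicity-pos {x} Sx = count-pos (level? x) (Sx , refl)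

  below⊥level : ∀ x → (λ z → S z × κ z < κ x) ⊥ (λ z → S z × κ z ≡ κ x)
  below⊥level x ((_ , κz<κx) , (_ , κz≡κx)) = <-irrefl κz≡κx κz<κx

  rank+multiplicity≤count : ∀ x → rank x + multiplicity x ≤ count S?
  rank+multiplicity≤count x =
    count-disjoint-≤ (below? x) (level? x) S? (below⊥level x) proj₁ proj₁

  rank+multiplicity≤rank : ∀ {x y} → κ x < κ y → rank x + multiplicity x ≤ rank y
  rank+multiplicity≤rank {x} {y} κx<κy =
    count-disjoint-≤ (below? x) (level? x) (below? y) (below⊥level x)
      (λ (Sz , κz<κx) → Sz , <-trans κz<κx κx<κy)
      (λ (Sz , κz≡κx) → Sz , subst (_< κ y) (sym κz≡κx) κx<κy)

  rank+s≤rank : ∀ {x y s} → s ≤ multiplicity x → κ x < κ y → rank x + s ≤ rank y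
  rank+s≤rank s≤mx κx<κy = ≤-trans (+-monoʳ-≤ _ s≤mx) (rank+multiplicity≤rank κx<κy)

  rank/-injective : ∀ {x y} s .{{_ : NonZero s}} →
    s ≤ multiplicity x → s ≤ multiplicity y → rank x / s ≡ rank y / s → κ x ≡ κ y
  rank/-injective {x} {y} s s≤mx s≤my eq with <-cmp (κ x) (κ y)
  ... | tri< κx<κy _ _ = contradiction eq (<⇒≢ (m+n≤o⇒m/n<o/n s (rank+s≤rank s≤mx κx<κy)))
  ... | tri≈ _ κx≡κy _ = κx≡κy
  ... | tri> _ _ κy<κx = contradiction (sym eq) (<⇒≢ (m+n≤o⇒m/n<o/n s (rank+s≤rank s≤my κy<κx)))

  rank-injective : ∀ {x y} → S x → S y → rank x ≡ rank y → κ x ≡ κ y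
  rank-injective Sx Sy eq =
    rank/-injective 1 (multiplicity-pos Sx) (multiplicity-pos Sy) (cong (_/ 1) eq)

Refines : ∀ {n} → SubsetP n → Partition n → Partition n → Set
Refines B Q R = ∀ {y z} → B y → B z → Q y ≡ Q z → R y ≡ R z

Refines-⊆ : ∀ {n} {B C : SubsetP n} {Q R : Partition n} → C ⊆ B → Refines B Q R → Refines C Q R
Refines-⊆ C⊆B B-refines Cy Cz = B-refines (C⊆B Cy) (C⊆B Cz)

refines⇒dist≡1 : ∀ {n} {B : SubsetP n} {Q R : Partition n} →
  (∃ λ x → B x) → Refines B Q R → DistB≡ B (lookup (Q ∷ R ∷ [])) 1
refines⇒dist≡1 {B = B} {Q} {R} (x₀ , Bx₀) Q⇒R = dist≤1 , dist≰0
  where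
  dist≤1 : DistCond B (lookup (Q ∷ R ∷ [])) 1
  dist≤1 zero () _ _
  dist≤1 (suc zero) _ x Bx = [] , [] , s≤s z≤n , λ where
    zero _ → (λ k → ∃ λ z → B z × Q z ≡ k × R z ≡ R x) , λ y By → mk⇔
      (λ where (_ , here Ry≡Rx) → y , By , refl , Ry≡Rx)
      (λ where (z , Bz , Qz≡Qy , Rz≡Rx) → By , here (trans (Q⇒R By Bz (sym Qz≡Qy)) Rz≡Rx))
    (suc _) (s≤s ())

  dist≰0 : ∀ Δ → Δ < 1 → ¬ DistCond B (lookup (Q ∷ R ∷ [])) Δ
  dist≰0 zero _ dist≤0 with dist≤0 (suc zero) (s≤s z≤n) x₀ Bx₀
  ... | _ , _ , () , _
  dist≰0 (suc _) (s≤s ())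

module BlockLabelling {n} (P₁ P₂ : Partition n) (b : ℕ) where

  colour? : ∀ c → Decidable (λ z → P₁ z ≡ c)
  colour? c z = P₁ z ≟ c

  size : ℕ → ℕ
  size c = count (colour? c)

  Large : Pred (Fin n) 0ℓ
  Large z = suc b ≤ size (P₁ z)

  module InColour (c : ℕ) = Rank (colour? c) P₂
  module AmongLarge = Rank (λ z → suc b ≤? size (P₁ z)) P₁

  rankInColour rankAmongLarge : Fin n → ℕ
  rankInColour y   = InColour.rank (P₁ y) y
  rankAmongLarge y = AmongLarge.rank y

  -- label decides through labelBy so that labelView can match on the same decision.
  labelBy : ∀ {y} → Dec (rankInColour y < b) → ℕ
  labelBy {y} (yes _) = rankInColour y
  labelBy {y} (no _)  = b + rankAmongLarge y / suc b

  label : Fin n → ℕ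
  label y = labelBy (rankInColour y <? b)

  data LabelView (y : Fin n) (ℓ : ℕ) : Set where
    small : rankInColour y < b → ℓ ≡ rankInColour y → LabelView y ℓ
    large : b ≤ rankInColour y → ℓ ≡ b + rankAmongLarge y / suc b → LabelView y ℓ

  labelView : ∀ y → LabelView y (label y)
  labelView y = viewBy (rankInColour y <? b)
    where
    viewBy : (d : Dec (rankInColour y < b)) → LabelView y (labelBy d)
    viewBy (yes r<b) = small r<b refl
    viewBy (no r≮b)  = large (≮⇒≥ r≮b) refl

  rankInColour<size : ∀ y → rankInColour y < size (P₁ y)
  rankInColour<size y = <-≤-trans
    (m<m+n _ (InColour.multiplicity-pos (P₁ y) refl))
    (InColour.rank+multiplicity≤count (P₁ y) y)

  large-colour : ∀ {y} → b ≤ rankInColour y → Large y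
  large-colour {y} b≤r = ≤-<-trans b≤r (rankInColour<size y)

  large⇒1+b≤multiplicity : ∀ {y} → Large y → suc b ≤ AmongLarge.multiplicity y
  large⇒1+b≤multiplicity {y} Ly = ≤-trans Ly
    (count-mono (colour? (P₁ y)) (AmongLarge.level? y)
      (λ P₁z≡P₁y → subst (λ c → suc b ≤ size c) (sym P₁z≡P₁y) Ly , P₁z≡P₁y))

  rankAmongLarge/[1+b]<n/[1+b] : ∀ {y} → Large y → rankAmongLarge y / suc b < n / suc b
  rankAmongLarge/[1+b]<n/[1+b] {y} Ly = m+n≤o⇒m/n<o/n (suc b) (begin
    rankAmongLarge y + suc b                       ≤⟨ +-monoʳ-≤ _ (large⇒1+b≤multiplicity Ly) ⟩
    rankAmongLarge y + AmongLarge.multiplicity y   ≤⟨ AmongLarge.rank+multiplicity≤count y ⟩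
    count (λ z → suc b ≤? size (P₁ z))             ≤⟨ count≤n _ ⟩
    n                                              ∎)
    where open ≤-Reasoning

  label<b+n/[1+b] : ∀ y → label y < b + n / suc b
  label<b+n/[1+b] y with labelView y
  ... | small r<b eq = subst (_< b + n / suc b) (sym eq) (<-≤-trans r<b (m≤m+n b _))
  ... | large b≤r eq = subst (_< b + n / suc b) (sym eq)
                         (+-monoʳ-< b (rankAmongLarge/[1+b]<n/[1+b] (large-colour b≤r)))

  small-blocks-refine : ∀ {k} → k < b →
    Refines (λ y → label y ≡ k) P₁ P₂
  small-blocks-refine {k} k<b {y} {z} ly lz P₁y≡P₁z with labelView y | labelView z
  ... | small _ eqy | small _ eqz = InColour.rank-injective (P₁ y) refl (sym P₁y≡P₁z) (begin
    InColour.rank (P₁ y) y  ≡⟨ trans (sym eqy) ly ⟩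
    k                       ≡⟨ trans (sym lz) eqz ⟩
    InColour.rank (P₁ z) z  ≡⟨ cong (λ c → InColour.rank c z) (sym P₁y≡P₁z) ⟩
    InColour.rank (P₁ y) z  ∎)
    where open ≡-Reasoning
  ... | large _ eqy | _ = contradiction (subst (b ≤_) (trans (sym eqy) ly) (m≤m+n b _)) (<⇒≱ k<b)
  ... | _ | large _ eqz = contradiction (subst (b ≤_) (trans (sym eqz) lz) (m≤m+n b _)) (<⇒≱ k<b)

  large-blocks-refine : ∀ {k} → b ≤ k →
    Refines (λ y → label y ≡ k) P₂ P₁
  large-blocks-refine {k} b≤k {y} {z} ly lz _ with labelView y | labelView z
  ... | large b≤ry eqy | large b≤rz eqz = AmongLarge.rank/-injective (suc b)
    (large⇒1+b≤multiplicity (large-colour b≤ry))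
    (large⇒1+b≤multiplicity (large-colour b≤rz))
    (+-cancelˡ-≡ b _ _ (trans (sym eqy) (trans ly (trans (sym lz) eqz))))
  ... | small r<b eqy | _ = contradiction (subst (_< b) (trans (sym eqy) ly) r<b) (≤⇒≯ b≤k)
  ... | _ | small r<b eqz = contradiction (subst (_< b) (trans (sym eqz) lz) r<b) (≤⇒≯ b≤k)

blockLabelling : ∀ {n} (P₁ P₂ : Partition n) (b : ℕ) →
  ∃ λ (h : Fin n → Fin (b + n / suc b)) → ∀ k →
    Refines (λ x → h x ≡ k) P₁ P₂ ⊎ Refines (λ x → h x ≡ k) P₂ P₁
blockLabelling {n} P₁ P₂ b = h , blocks
  where
  open BlockLabelling P₁ P₂ b

  h : Fin n → Fin (b + n / suc b)
  h y = fromℕ< (label<b+n/[1+b] y)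

  label≡ : ∀ {y k} → h y ≡ k → label y ≡ toℕ k
  label≡ hy≡k = trans (sym (toℕ-fromℕ< _)) (cong toℕ hy≡k)

  blocks : ∀ k → Refines (λ x → h x ≡ k) P₁ P₂ ⊎ Refines (λ x → h x ≡ k) P₂ P₁
  blocks k with toℕ k <? b
  ... | yes k<b = inj₁ λ hy hz → small-blocks-refine k<b (label≡ hy) (label≡ hz)
  ... | no k≮b  = inj₂ λ hy hz → large-blocks-refine (≮⇒≥ k≮b) (label≡ hy) (label≡ hz)

record ImageFactorisation {n K : ℕ} (h : Fin n → Fin K) : Set where
  field
    m               : ℕ
    onto            : Fin n → Fin m
    embed           : Fin m → Fin K
    embed-injective : Injective _≡_ _≡_ embed
    factorises      : ∀ x → embed (onto x) ≡ h x
    onto-surjective : ∀ i → ∃ λ x → onto x ≡ i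

  m≤K : m ≤ K
  m≤K = injective⇒≤ embed-injective

  onto-fibre⊆h-fibre : ∀ {x i} → onto x ≡ i → h x ≡ embed i
  onto-fibre⊆h-fibre {x} ontox≡i = trans (sym (factorises x)) (cong embed ontox≡i)

imageFactorisation : ∀ {n K} (h : Fin n → Fin K) → ImageFactorisation h
imageFactorisation {zero} h = record
  { m = 0 ; onto = λ () ; embed = λ () ; embed-injective = λ {} ; factorises = λ () ; onto-surjective = λ () }
imageFactorisation {suc n} {K} h with imageFactorisation (h ∘ suc)
... | record { m = m ; onto = onto ; embed = embed ; embed-injective = embed-injective
             ; factorises = factorises ; onto-surjective = onto-surjective }
  with any? (λ i → embed i ≟ᶠ h zero)
... | yes (i , embedi≡h0) = record
  { m = m ; onto = onto′ ; embed = embed ; embed-injective = embed-injective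
  ; factorises = factorises′ ; onto-surjective = λ j → suc (proj₁ (onto-surjective j)) , proj₂ (onto-surjective j) }
  where
  onto′ : Fin (suc n) → Fin m
  onto′ zero    = i
  onto′ (suc x) = onto x
  factorises′ : ∀ x → embed (onto′ x) ≡ h x
  factorises′ zero    = embedi≡h0
  factorises′ (suc x) = factorises x
... | no h0∉image = record
  { m = suc m ; onto = onto′ ; embed = embed′ ; embed-injective = embed′-injective
  ; factorises = factorises′ ; onto-surjective = onto′-surjective }
  where
  onto′ : Fin (suc n) → Fin (suc m)
  onto′ zero    = zero
  onto′ (suc x) = suc (onto x)
  embed′ : Fin (suc m) → Fin K
  embed′ zero    = h zero
  embed′ (suc i) = embed i
  embed′-injective : Injective _≡_ _≡_ embed′
  embed′-injective {zero}  {zero}  _  = refl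
  embed′-injective {zero}  {suc j} eq = contradiction (j , sym eq) h0∉image
  embed′-injective {suc i} {zero}  eq = contradiction (i , eq) h0∉image
  embed′-injective {suc i} {suc j} eq = cong suc (embed-injective eq)
  factorises′ : ∀ x → embed′ (onto′ x) ≡ h x
  factorises′ zero    = refl
  factorises′ (suc x) = factorises x
  onto′-surjective : ∀ i → ∃ λ x → onto′ x ≡ i
  onto′-surjective zero    = zero , refl
  onto′-surjective (suc i) = suc (proj₁ (onto-surjective i)) , cong suc (proj₂ (onto-surjective i))

between-squares : ∀ {n} → 1 ≤ n → ∃ λ b → b * b < n × n ≤ suc b * suc b
between-squares {suc zero}    _ = 0 , s≤s z≤n , s≤s z≤n
between-squares {suc (suc n)} _ with between-squares {suc n} (s≤s z≤n)
... | b , b²<1+n , 1+n≤[1+b]² with suc (suc n) ≤? suc b * suc b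
... | yes 2+n≤[1+b]² = b , m≤n⇒m≤1+n b²<1+n , 2+n≤[1+b]²
... | no  2+n≰[1+b]² = suc b , ≰⇒> 2+n≰[1+b]² , s≤s (≤-trans 1+n≤[1+b]² [1+b]²≤1+b+[1+b][2+b])
  where
  [1+b]²≤1+b+[1+b][2+b] : suc b * suc b ≤ suc b + suc b * suc (suc b)
  [1+b]²≤1+b+[1+b][2+b] = ≤-trans (*-monoʳ-≤ (suc b) (n≤1+n (suc b))) (m≤n+m _ (suc b))

[b+n/[1+b]]²<4n : ∀ {b n} → b * b < n → n ≤ suc b * suc b →
  (b + n / suc b) * (b + n / suc b) < 4 * n
[b+n/[1+b]]²<4n {b} {n} b²<n n≤[1+b]² = begin-strict
  (b + q) * (b + q)                     ≡⟨ expand b q ⟩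
  b * b + (q * b + q * b + q * q)       ≤⟨ +-monoʳ-≤ (b * b) (+-mono-≤ (+-mono-≤ qb≤qs qb≤qs) q²≤qs) ⟩
  b * b + (q * s + q * s + q * s)       <⟨ +-monoˡ-< _ b²<n ⟩
  n + (q * s + q * s + q * s)           ≤⟨ +-monoʳ-≤ n (+-mono-≤ (+-mono-≤ qs≤n qs≤n) qs≤n) ⟩
  n + (n + n + n)                       ≡⟨ four n ⟩
  4 * n                                 ∎
  where
  open ≤-Reasoning
  open +-*-Solver
  s q : ℕ
  s = suc b
  q = n / s
  qs≤n : q * s ≤ n
  qs≤n = m/n*n≤m n s
  qb≤qs : q * b ≤ q * s
  qb≤qs = *-monoʳ-≤ q (n≤1+n b)
  q²≤qs : q * q ≤ q * s
  q²≤qs = *-monoʳ-≤ q (*-cancelʳ-≤ q s s (≤-trans qs≤n n≤[1+b]²))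
  expand : ∀ b q → (b + q) * (b + q) ≡ b * b + (q * b + q * b + q * q)
  expand = solve 2 (λ b q → (b :+ q) :* (b :+ q) := b :* b :+ (q :* b :+ q :* b :+ q :* q)) refl
  four : ∀ n → n + (n + n + n) ≡ 4 * n
  four = solve 1 (λ n → n :+ (n :+ n :+ n) := con 4 :* n) refl

mainTheorem10 : (n : ℕ) → 1 ≤ n → (P₁ P₂ : Partition n) →
    ∃ λ (m : ℕ) → ∃ λ (g : Fin n → Fin m) →
    (∀ (i : Fin m) → ∃ λ (x : Fin n) → g x ≡ i) ×
    m * m < 4 * n ×
    (∀ (i : Fin m) →
    DistB≡ (λ x → g x ≡ i) (lookup (P₁ ∷ P₂ ∷ [])) 1 ⊎
    DistB≡ (λ x → g x ≡ i) (lookup (P₂ ∷ P₁ ∷ [])) 1)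
mainTheorem10 n 1≤n P₁ P₂ with between-squares 1≤n
... | b , b²<n , n≤[1+b]² with blockLabelling P₁ P₂ b
... | h , h-blocks = m , onto , onto-surjective , m²<4n , blocks
  where
  open ImageFactorisation (imageFactorisation h)

  m²<4n : m * m < 4 * n
  m²<4n = ≤-<-trans (*-mono-≤ m≤K m≤K) ([b+n/[1+b]]²<4n {b} b²<n n≤[1+b]²)

  blocks : ∀ i → DistB≡ (λ x → onto x ≡ i) (lookup (P₁ ∷ P₂ ∷ [])) 1
               ⊎ DistB≡ (λ x → onto x ≡ i) (lookup (P₂ ∷ P₁ ∷ [])) 1
  blocks i with h-blocks (embed i)
  ... | inj₁ P₁⇒P₂ = inj₁ (refines⇒dist≡1 (onto-surjective i) (Refines-⊆ {Q = P₁} onto-fibre⊆h-fibre P₁⇒P₂))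
  ... | inj₂ P₂⇒P₁ = inj₂ (refines⇒dist≡1 (onto-surjective i) (Refines-⊆ {Q = P₂} onto-fibre⊆h-fibre P₂⇒P₁))
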